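{- Let $q$ be a prime power, let $f\in\mathbb{F}_q[x]$ be a shifting Costas polynomial and let $s$ be a positive integer. Then $f(x^s)$ is a shifting Costas polynomial if and only if $\gcd(s,q-1)=1$.
   Context: A shifting Costas polynomial is a permutation polynomial $f\in\mathbb{F}_q[x]$ (i.e. inducing a bijection of $\mathbb{F}_q$) such that for every $d\in\mathbb{F}_q$ with $d\neq1$ there exists $a\in\mathbb{F}_q^*$ with $f(dx)-f(x)=f(ax)$ (as functions on $\mathbb{F}_q$, equivalently modulo $x^q-x$). -}

module Defs where

open import Level using (0ℓ)
open import Data.Nat as ℕ using (ℕ; zero; suc)
open import Data.Nat.Primality using (Prime)
open import Data.Fin using (Fin)
open import Data.Product using (Σ; ∃; _×_; _,_)
open import Relation.Binary.PropositionalEquality using (_≡_; _≢_)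
open import Algebra.Structures using (IsCommutativeRing)
open import Function.Bundles using (Bijection)
open import Function.Definitions using (Bijective)
open import Relation.Binary.PropositionalEquality using (setoid)

IsPrimePower : ℕ → Set
IsPrimePower q = Σ ℕ λ p → Σ ℕ λ k → Prime p × (1 ℕ.≤ k) × (q ≡ p ℕ.^ k)

record FiniteField (q : ℕ) : Set₁ where
  infixl 7 _*_
  infixl 6 _+_ _-_
  field
    Carrier : Set
    _+_ _*_ : Carrier → Carrier → Carrier
    -_      : Carrier → Carrier
    0# 1#   : Carrier
    isCommutativeRing : IsCommutativeRing _≡_ _+_ _*_ -_ 0# 1#
    0≢1     : 0# ≢ 1#
    inverse : ∀ x → x ≢ 0# → ∃ λ y → x * y ≡ 1#
    enum    : Bijection (setoid (Fin q)) (setoid Carrier)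

  _-_ : Carrier → Carrier → Carrier
  x - y = x + (- y)

  _^_ : Carrier → ℕ → Carrier
  x ^ zero  = 1#
  x ^ suc n = x * (x ^ n)

  -- permutation polynomial: the induced map F_q → F_q is a bijection
  IsPermutation : (Carrier → Carrier) → Set
  IsPermutation f = Bijective _≡_ _≡_ f

  IsShiftingCostas : (Carrier → Carrier) → Set
  IsShiftingCostas f =
    IsPermutation f ×
    (∀ d → d ≢ 1# → ∃ λ a → a ≢ 0# × (∀ x → f (d * x) - f x ≡ f (a * x)))

{-# OPTIONS --safe #-}
-- If gcd (s, q - 1) = 1, Bézout and Fermat (x ^ q = x) give u with (x ^ s) ^ u = x = (x ^ u) ^ s, so
-- x ↦ x ^ s is a multiplicative permutation of F, and precomposing with such a permutation σ preserves
-- the shifting Costas property (the witness a for σ d becomes σ⁻¹ a). Conversely, if f (x ^ s) is a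
-- permutation, so is x ↦ x ^ d for d = gcd (s, q - 1). Writing q - 1 = m d, every x ≠ 0 then has
-- x ^ m = 1, so the monic polynomial x ^ (m + 1) - x has all q elements as roots, whence q ≤ m + 1
-- and d = 1.
module Submission where

open import Defs
open import Data.Nat using (ℕ; _∸_; _≤_)
open import Data.Nat.GCD using (gcd)
open import Relation.Binary.PropositionalEquality using (_≡_)
open import Function.Bundles using (_⇔_)

open import Level using (0ℓ)
open import Data.Nat as ℕ using (zero; suc; _<_; z≤n; s≤s)
import Data.Nat.Properties as ℕ
open import Data.Nat.GCD using (gcd-GCD; gcd[m,n]∣m; gcd[m,n]∣n; gcd[m,n]≢0; module Bézout)
open import Data.Nat.Divisibility using (_∣_; divides)
open import Data.Nat.Tactic.RingSolver using (solve-∀)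
open import Data.Fin as Fin using (Fin; punchIn)
import Data.Fin.Properties as Fin
open import Data.Fin.Permutation using (Permutation; permutation; _⟨$⟩ʳ_)
open import Data.Vec using (Vec; []; _∷_; replicate)
open import Data.Product using (∃; ∃₂; _×_; _,_; proj₁; proj₂)
open import Data.Sum using (inj₁)
open import Relation.Nullary using (yes; no; Dec; contradiction)
open import Relation.Nullary.Decidable using (decidable-stable)
open import Relation.Binary.PropositionalEquality
  using (_≢_; refl; sym; trans; cong; cong₂; subst; module ≡-Reasoning)
open import Function using (_∘_; mk⇔)
open import Function.Bundles using (Bijection; Surjection)
open import Function.Definitions using (Injective; Bijective)
open import Function.Consequences using (inverseᵇ⇒bijective)
open import Function.Consequences.Propositional
  using (strictlyInverseˡ⇒inverseˡ; strictlyInverseʳ⇒inverseʳ)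
import Function.Construct.Composition as Composition
import Algebra.Properties.CommutativeMonoid.Sum as SumProperties
open import Algebra.Bundles using (CommutativeMonoid; CommutativeRing)
open import Algebra.Structures using (IsCommutativeRing)

open Bézout.Identity using (Identity; +-; -+)

module _ where
  open import Data.Nat using (_+_; _*_)

  -- Bézout's identity over ℕ comes in two sign patterns; the second, 1 + x s = y n,
  -- is turned into the first by the inverse u = x (n - 1) + n.
  bézout⇒inverse : ∀ {s n} → 1 ≤ s → Identity 1 s n → ∃₂ λ u k → u * s ≡ 1 + k * n
  bézout⇒inverse _ (+- x y eq) = x , y , sym eq
  bézout⇒inverse {n = zero} _ (-+ x y eq) = contradiction (trans eq (ℕ.*-zeroʳ y)) λ ()
  bézout⇒inverse {suc s′} {suc m} _ (-+ x y eq) =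
    x * m + suc m , y * m + s′ , ℕ.+-cancelˡ-≡ m _ _ (begin
      m + (x * m + suc m) * suc s′           ≡⟨ expand x m s′ ⟩
      m * (1 + x * suc s′) + suc m * suc s′  ≡⟨ cong (λ t → m * t + suc m * suc s′) eq ⟩
      m * (y * suc m) + suc m * suc s′       ≡⟨ collect y m s′ ⟩
      m + (1 + (y * m + s′) * suc m)         ∎)
    where
    open ≡-Reasoning
    expand : ∀ x m s′ → m + (x * m + suc m) * suc s′ ≡ m * (1 + x * suc s′) + suc m * suc s′
    expand = solve-∀
    collect : ∀ y m s′ → m * (y * suc m) + suc m * suc s′ ≡ m + (1 + (y * m + s′) * suc m)
    collect = solve-∀

  coprime⇒inverse : ∀ {s n} → 1 ≤ s → gcd s n ≡ 1 → ∃₂ λ u k → u * s ≡ 1 + k * n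
  coprime⇒inverse {s} {n} 1≤s gcd≡1 =
    bézout⇒inverse 1≤s (subst (λ d → Identity d s n) gcd≡1 (Bézout.identity (gcd-GCD s n)))

module FiniteFieldProperties {q : ℕ} (F : FiniteField q) where
  open FiniteField F
  open IsCommutativeRing isCommutativeRing
    using (+-identityˡ; -‿inverseˡ; *-assoc; *-comm; *-identityˡ; *-identityʳ;
           distribˡ; zeroˡ; zeroʳ; *-isCommutativeMonoid)
  open ≡-Reasoning

  commutativeRing : CommutativeRing 0ℓ 0ℓ
  commutativeRing = record { isCommutativeRing = isCommutativeRing }

  open import Algebra.Solver.Ring.NaturalCoefficients.Default (CommutativeRing.commutativeSemiring commutativeRing)
    using (solve; _:=_; _:+_; _:*_)

  enumerate : Fin q → Carrier
  enumerate = Bijection.to enum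

  index : Carrier → Fin q
  index = Bijection.to⁻ enum

  enumerate-index : ∀ x → enumerate (index x) ≡ x
  enumerate-index = Surjection.to∘to⁻ (Bijection.surjection enum)

  enumerate-injective : Injective _≡_ _≡_ enumerate
  enumerate-injective = Bijection.injective enum

  index-injective : Injective _≡_ _≡_ index
  index-injective {x} {y} eq = begin
    x                      ≡⟨ enumerate-index x ⟨
    enumerate (index x)    ≡⟨ cong enumerate eq ⟩
    enumerate (index y)    ≡⟨ enumerate-index y ⟩
    y                      ∎

  index-enumerate : ∀ i → index (enumerate i) ≡ i
  index-enumerate i = enumerate-injective (enumerate-index (enumerate i))

  infix 4 _≟_
  _≟_ : (x y : Carrier) → Dec (x ≡ y)
  x ≟ y with index x Fin.≟ index y
  ... | yes eq = yes (index-injective eq)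
  ... | no neq = no (neq ∘ cong index)

  1<q : 1 < q
  1<q = two-distinct (index 0#) (index 1#) (0≢1 ∘ index-injective)
    where
    two-distinct : ∀ {n} (i j : Fin n) → i ≢ j → 1 < n
    two-distinct {suc zero} Fin.zero Fin.zero i≢j = contradiction refl i≢j
    two-distinct {suc (suc n)} _ _ _ = s≤s (s≤s z≤n)

  suc[q∸1]≡q : suc (q ∸ 1) ≡ q
  suc[q∸1]≡q = ℕ.suc-pred q {{ℕ.>-nonZero (ℕ.<-trans (s≤s z≤n) 1<q)}}

  inv : ∀ x → x ≢ 0# → Carrier
  inv x x≢0 = proj₁ (inverse x x≢0)

  inv-inverseʳ : ∀ {x} (x≢0 : x ≢ 0#) → x * inv x x≢0 ≡ 1#
  inv-inverseʳ {x} x≢0 = proj₂ (inverse x x≢0)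

  inv-inverseˡ : ∀ {x} (x≢0 : x ≢ 0#) → inv x x≢0 * x ≡ 1#
  inv-inverseˡ {x} x≢0 = trans (*-comm _ x) (inv-inverseʳ x≢0)

  inv-cancelˡ : ∀ {x} (x≢0 : x ≢ 0#) y → inv x x≢0 * (x * y) ≡ y
  inv-cancelˡ {x} x≢0 y = begin
    inv x x≢0 * (x * y)  ≡⟨ *-assoc _ x y ⟨
    (inv x x≢0 * x) * y  ≡⟨ cong (_* y) (inv-inverseˡ x≢0) ⟩
    1# * y               ≡⟨ *-identityˡ y ⟩
    y                    ∎

  inv-cancelʳ : ∀ {x} (x≢0 : x ≢ 0#) y → x * (inv x x≢0 * y) ≡ y
  inv-cancelʳ {x} x≢0 y = begin
    x * (inv x x≢0 * y)  ≡⟨ *-assoc x _ y ⟨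
    (x * inv x x≢0) * y  ≡⟨ cong (_* y) (inv-inverseʳ x≢0) ⟩
    1# * y               ≡⟨ *-identityˡ y ⟩
    y                    ∎

  *-cancelˡ : ∀ {a x y} → a ≢ 0# → a * x ≡ a * y → x ≡ y
  *-cancelˡ {a} {x} {y} a≢0 ax≡ay = begin
    x                    ≡⟨ inv-cancelˡ a≢0 x ⟨
    inv a a≢0 * (a * x)  ≡⟨ cong (inv a a≢0 *_) ax≡ay ⟩
    inv a a≢0 * (a * y)  ≡⟨ inv-cancelˡ a≢0 y ⟩
    y                    ∎

  *-cancelʳ : ∀ {a x y} → a ≢ 0# → x * a ≡ y * a → x ≡ y
  *-cancelʳ {a} {x} {y} a≢0 xa≡ya = *-cancelˡ a≢0 (trans (*-comm a x) (trans xa≡ya (*-comm y a)))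

  x*y≢0 : ∀ {x y} → x ≢ 0# → y ≢ 0# → x * y ≢ 0#
  x*y≢0 {x} x≢0 y≢0 xy≡0 = y≢0 (*-cancelˡ x≢0 (trans xy≡0 (sym (zeroʳ x))))

  *-commutativeMonoid : CommutativeMonoid 0ℓ 0ℓ
  *-commutativeMonoid = record { isCommutativeMonoid = *-isCommutativeMonoid }

  open import Algebra.Properties.CommutativeMonoid.Mult *-commutativeMonoid
    using (×-homo-+; ×-assocˡ; ×-distrib-+) renaming (_×_ to _·_)

  ^≗· : ∀ x n → x ^ n ≡ n · x
  ^≗· x zero    = refl
  ^≗· x (suc n) = cong (x *_) (^≗· x n)

  ^-distribˡ-+-* : ∀ x m n → x ^ (m ℕ.+ n) ≡ x ^ m * x ^ n
  ^-distribˡ-+-* x m n rewrite ^≗· x (m ℕ.+ n) | ^≗· x m | ^≗· x n = ×-homo-+ x m n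

  ^-*-assoc : ∀ x m n → (x ^ m) ^ n ≡ x ^ (m ℕ.* n)
  ^-*-assoc x m n rewrite ^≗· (x ^ m) n | ^≗· x m | ^≗· x (m ℕ.* n) | ℕ.*-comm m n = ×-assocˡ x n m

  ^-distribʳ-* : ∀ x y n → (x * y) ^ n ≡ x ^ n * y ^ n
  ^-distribʳ-* x y n rewrite ^≗· (x * y) n | ^≗· x n | ^≗· y n = ×-distrib-+ x y n

  1^n≡1 : ∀ n → 1# ^ n ≡ 1#
  1^n≡1 zero    = refl
  1^n≡1 (suc n) = trans (*-identityˡ _) (1^n≡1 n)

  0^n≡0 : ∀ n → 1 ≤ n → 0# ^ n ≡ 0#
  0^n≡0 (suc n) _ = zeroˡ _

  module Π = SumProperties *-commutativeMonoid

  ∏ : (Carrier → Carrier) → Carrier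
  ∏ h = Π.sum (h ∘ enumerate)

  ∏-distrib : ∀ g h → ∏ (λ x → g x * h x) ≡ ∏ g * ∏ h
  ∏-distrib g h = Π.∑-distrib-+ (g ∘ enumerate) (h ∘ enumerate)

  ∏-const : ∀ a → ∏ (λ _ → a) ≡ a ^ q
  ∏-const a = trans (Π.sum-replicate q) (sym (^≗· a q))

  ∏-reindex : ∀ σ τ h → (∀ x → σ (τ x) ≡ x) → (∀ x → τ (σ x) ≡ x) → ∏ (h ∘ σ) ≡ ∏ h
  ∏-reindex σ τ h στ τσ = sym (begin
    Π.sum (h ∘ enumerate)              ≡⟨ Π.sum-permute (h ∘ enumerate) π ⟩
    Π.sum (h ∘ enumerate ∘ (π ⟨$⟩ʳ_))  ≡⟨ Π.sum-cong-≗ (cong h ∘ enumerate-index ∘ σ ∘ enumerate) ⟩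
    Π.sum (h ∘ σ ∘ enumerate)          ∎)
    where
    lift : (Carrier → Carrier) → Fin q → Fin q
    lift φ = index ∘ φ ∘ enumerate
    lift-inverse : ∀ {φ ψ} → (∀ x → φ (ψ x) ≡ x) → ∀ i → lift φ (lift ψ i) ≡ i
    lift-inverse {φ} {ψ} φψ i = begin
      index (φ (enumerate (index (ψ (enumerate i))))) ≡⟨ cong (index ∘ φ) (enumerate-index _) ⟩
      index (φ (ψ (enumerate i)))                     ≡⟨ cong index (φψ _) ⟩
      index (enumerate i)                             ≡⟨ index-enumerate i ⟩
      i                                               ∎
    π : Permutation q q
    π = permutation (lift σ) (lift τ) (lift-inverse {σ} {τ} στ) (lift-inverse {τ} {σ} τσ)

  ∏-at : ∀ h x₀ → (∀ x → x ≢ x₀ → h x ≡ 1#) → ∏ h ≡ h x₀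
  ∏-at h x₀ h≡1 = begin
    Π.sum (h ∘ enumerate)     ≡⟨ sum-at (h ∘ enumerate) (index x₀) (λ i i≢i₀ → h≡1 _ (i≢i₀ ∘ ≡index)) ⟩
    h (enumerate (index x₀))  ≡⟨ cong h (enumerate-index x₀) ⟩
    h x₀                      ∎
    where
    ≡index : ∀ {i} → enumerate i ≡ x₀ → i ≡ index x₀
    ≡index {i} eq = trans (sym (index-enumerate i)) (cong index eq)
    sum-at : ∀ {n} (t : Fin n → Carrier) i → (∀ j → j ≢ i → t j ≡ 1#) → Π.sum t ≡ t i
    sum-at {suc n} t i t≡1 = begin
      Π.sum t                         ≡⟨ Π.sum-remove t ⟩
      t i * Π.sum (t ∘ punchIn i)     ≡⟨ cong (t i *_) (Π.sum-cong-≗ (t≡1 _ ∘ Fin.punchInᵢ≢i i)) ⟩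
      t i * Π.sum {n} (λ _ → 1#)      ≡⟨ cong (t i *_) (Π.sum-replicate-zero n) ⟩
      t i * 1#                        ≡⟨ *-identityʳ (t i) ⟩
      t i                             ∎

  ∏-≢0 : ∀ h → (∀ x → h x ≢ 0#) → ∏ h ≢ 0#
  ∏-≢0 h h≢0 = sum-≢0 (h ∘ enumerate) (h≢0 ∘ enumerate)
    where
    sum-≢0 : ∀ {n} (t : Fin n → Carrier) → (∀ i → t i ≢ 0#) → Π.sum t ≢ 0#
    sum-≢0 {zero}  t t≢0 = 0≢1 ∘ sym
    sum-≢0 {suc n} t t≢0 = x*y≢0 (t≢0 Fin.zero) (sum-≢0 (t ∘ Fin.suc) (t≢0 ∘ Fin.suc))

  unit : Carrier → Carrier
  unit y with y ≟ 0#
  ... | yes _ = 1#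
  ... | no  _ = y

  unit≢0 : ∀ y → unit y ≢ 0#
  unit≢0 y with y ≟ 0#
  ... | yes _   = 0≢1 ∘ sym
  ... | no  y≢0 = y≢0

  atZero : Carrier → Carrier → Carrier
  atZero a y with y ≟ 0#
  ... | yes _ = a
  ... | no  _ = 1#

  ∏-atZero : ∀ a → ∏ (atZero a) ≡ a
  ∏-atZero a = trans (∏-at (atZero a) 0# atZero-≢0) atZero-0
    where
    atZero-≢0 : ∀ y → y ≢ 0# → atZero a y ≡ 1#
    atZero-≢0 y y≢0 with y ≟ 0#
    ... | yes y≡0 = contradiction y≡0 y≢0
    ... | no  _   = refl
    atZero-0 : atZero a 0# ≡ a
    atZero-0 with 0# ≟ 0#
    ... | yes _   = refl
    ... | no  0≢0 = contradiction refl 0≢0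

  *-unit : ∀ {x} → x ≢ 0# → ∀ y → x * unit y ≡ unit (x * y) * atZero x y
  *-unit {x} x≢0 y with y ≟ 0# | x * y ≟ 0#
  ... | yes _   | yes _    = trans (*-identityʳ x) (sym (*-identityˡ x))
  ... | yes y≡0 | no xy≢0  = contradiction (trans (cong (x *_) y≡0) (zeroʳ x)) xy≢0
  ... | no  y≢0 | yes xy≡0 = contradiction xy≡0 (x*y≢0 x≢0 y≢0)
  ... | no  _   | no  _    = sym (*-identityʳ _)

  -- ∏ (λ y → x * unit y) is x ^ q * ∏ unit, and also ∏ unit * x: reindex along y ↦ x * y.
  x^q≡x : ∀ x → x ^ q ≡ x
  x^q≡x x with x ≟ 0#
  ... | yes refl = 0^n≡0 q (ℕ.<-trans (s≤s z≤n) 1<q)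
  ... | no x≢0 = *-cancelʳ (∏-≢0 unit unit≢0) (begin
    x ^ q * ∏ unit                       ≡⟨ cong (_* ∏ unit) (∏-const x) ⟨
    ∏ (λ _ → x) * ∏ unit                 ≡⟨ ∏-distrib (λ _ → x) unit ⟨
    ∏ (λ y → x * unit y)                 ≡⟨ Π.sum-cong-≗ (*-unit x≢0 ∘ enumerate) ⟩
    ∏ (λ y → unit (x * y) * atZero x y)  ≡⟨ ∏-distrib (unit ∘ (x *_)) (atZero x) ⟩
    ∏ (unit ∘ (x *_)) * ∏ (atZero x)     ≡⟨ cong₂ _*_ reindex (∏-atZero x) ⟩
    ∏ unit * x                           ≡⟨ *-comm (∏ unit) x ⟩
    x * ∏ unit                           ∎)
    where
    reindex : ∏ (unit ∘ (x *_)) ≡ ∏ unit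
    reindex = ∏-reindex (x *_) (inv x x≢0 *_) unit (inv-cancelʳ x≢0) (inv-cancelˡ x≢0)

  -- c₀ ∷ … ∷ cₙ₋₁ stands for the monic polynomial c₀ + c₁ x + … + cₙ₋₁ xⁿ⁻¹ + xⁿ.
  evalMonic : ∀ {n} → Vec Carrier n → Carrier → Carrier
  evalMonic []       x = 1#
  evalMonic (c ∷ cs) x = c + x * evalMonic cs x

  divide : ∀ {n} → Carrier → Vec Carrier (suc n) → Vec Carrier n
  divide r (c ∷ [])          = []
  divide r (c ∷ cs@(_ ∷ _)) = evalMonic cs r ∷ divide r cs

  -- P(x) - P(r) = (x - r) Q(x), with both sides moved so that it is a semiring identity.
  evalMonic-divide : ∀ {n} r (cs : Vec Carrier (suc n)) x →
    evalMonic cs x + r * evalMonic (divide r cs) x ≡ evalMonic cs r + x * evalMonic (divide r cs) x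
  evalMonic-divide r (c ∷ []) x =
    solve 4 (λ c x r e → (c :+ x :* e) :+ r :* e := (c :+ r :* e) :+ x :* e) refl c x r 1#
  evalMonic-divide r (c ∷ cs@(_ ∷ _)) x = begin
    (c + x * P) + r * (A + x * Q) ≡⟨ regroup c x r P A Q ⟩
    (c + r * A) + x * (P + r * Q) ≡⟨ cong (λ t → (c + r * A) + x * t) (evalMonic-divide r cs x) ⟩
    (c + r * A) + x * (A + x * Q) ∎
    where
    regroup : ∀ c x r P A Q → (c + x * P) + r * (A + x * Q) ≡ (c + r * A) + x * (P + r * Q)
    regroup = solve 6 (λ c x r P A Q →
      (c :+ x :* P) :+ r :* (A :+ x :* Q) := (c :+ r :* A) :+ x :* (P :+ r :* Q)) refl
    P A Q : Carrier
    P = evalMonic cs x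
    A = evalMonic cs r
    Q = evalMonic (divide r cs) x

  monic-roots≤degree : ∀ {n k} (cs : Vec Carrier n) (r : Fin k → Carrier) → Injective _≡_ _≡_ r →
                       (∀ i → evalMonic cs (r i) ≡ 0#) → k ≤ n
  monic-roots≤degree {k = zero}  cs         r _     _     = z≤n
  monic-roots≤degree {k = suc k} []         r _     roots = contradiction (sym (roots Fin.zero)) 0≢1
  monic-roots≤degree {k = suc k} cs@(_ ∷ _) r r-inj roots =
    s≤s (monic-roots≤degree (divide r₀ cs) (r ∘ Fin.suc) (Fin.suc-injective ∘ r-inj) quotient-roots)
    where
    r₀ : Carrier
    r₀ = r Fin.zero
    quotient-roots : ∀ i → evalMonic (divide r₀ cs) (r (Fin.suc i)) ≡ 0#
    quotient-roots i = decidable-stable (Q ≟ 0#) λ Q≢0 → Fin.0≢1+n (r-inj (*-cancelʳ Q≢0 r₀Q≡rᵢQ))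
      where
      rᵢ Q : Carrier
      rᵢ = r (Fin.suc i)
      Q = evalMonic (divide r₀ cs) rᵢ
      r₀Q≡rᵢQ : r₀ * Q ≡ rᵢ * Q
      r₀Q≡rᵢQ = begin
        r₀ * Q                        ≡⟨ +-identityˡ _ ⟨
        0# + r₀ * Q                   ≡⟨ cong (_+ r₀ * Q) (roots (Fin.suc i)) ⟨
        evalMonic cs rᵢ + r₀ * Q      ≡⟨ evalMonic-divide r₀ cs rᵢ ⟩
        evalMonic cs r₀ + rᵢ * Q      ≡⟨ cong (_+ rᵢ * Q) (roots Fin.zero) ⟩
        0# + rᵢ * Q                   ≡⟨ +-identityˡ _ ⟩
        rᵢ * Q                        ∎

  evalMonic-zeros : ∀ j x → evalMonic (replicate j 0#) x ≡ x ^ j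
  evalMonic-zeros zero    x = refl
  evalMonic-zeros (suc j) x = trans (+-identityˡ _) (cong (x *_) (evalMonic-zeros j x))

  x^[2+j]≡x⇒q≤2+j : ∀ j → (∀ x → x ^ (2 ℕ.+ j) ≡ x) → q ≤ 2 ℕ.+ j
  x^[2+j]≡x⇒q≤2+j j x^[2+j]≡x =
    monic-roots≤degree (0# ∷ - 1# ∷ replicate j 0#) enumerate enumerate-injective (root ∘ enumerate)
    where
    root : ∀ x → evalMonic (0# ∷ - 1# ∷ replicate j 0#) x ≡ 0#
    root x = begin
      0# + x * (- 1# + x * evalMonic (replicate j 0#) x) ≡⟨ +-identityˡ _ ⟩
      x * (- 1# + x * evalMonic (replicate j 0#) x)      ≡⟨ cong (λ t → x * (- 1# + x * t)) (evalMonic-zeros j x) ⟩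
      x * (- 1# + x ^ suc j)                              ≡⟨ distribˡ x (- 1#) _ ⟩
      x * - 1# + x ^ (2 ℕ.+ j)                            ≡⟨ cong (x * - 1# +_) (x^[2+j]≡x x) ⟩
      x * - 1# + x                                        ≡⟨ cong (x * - 1# +_) (*-identityʳ x) ⟨
      x * - 1# + x * 1#                                   ≡⟨ distribˡ x (- 1#) 1# ⟨
      x * (- 1# + 1#)                                     ≡⟨ cong (x *_) (-‿inverseˡ 1#) ⟩
      x * 0#                                              ≡⟨ zeroʳ x ⟩
      0#                                                  ∎

  x^[q∸1]≡1 : ∀ {x} → x ≢ 0# → x ^ (q ∸ 1) ≡ 1#
  x^[q∸1]≡1 {x} x≢0 = *-cancelˡ x≢0 (begin
    x * x ^ (q ∸ 1)  ≡⟨ cong (x ^_) suc[q∸1]≡q ⟩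
    x ^ q            ≡⟨ x^q≡x x ⟩
    x                ≡⟨ *-identityʳ x ⟨
    x * 1#           ∎)

  x^[1+k*[q∸1]]≡x : ∀ k x → x ^ suc (k ℕ.* (q ∸ 1)) ≡ x
  x^[1+k*[q∸1]]≡x zero    x = *-identityʳ x
  x^[1+k*[q∸1]]≡x (suc k) x = begin
    x ^ (suc (q ∸ 1) ℕ.+ k ℕ.* (q ∸ 1))      ≡⟨ ^-distribˡ-+-* x (suc (q ∸ 1)) _ ⟩
    x ^ suc (q ∸ 1) * x ^ (k ℕ.* (q ∸ 1))    ≡⟨ cong (λ n → x ^ n * x ^ (k ℕ.* (q ∸ 1))) suc[q∸1]≡q ⟩
    x ^ q * x ^ (k ℕ.* (q ∸ 1))              ≡⟨ cong (_* x ^ (k ℕ.* (q ∸ 1))) (x^q≡x x) ⟩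
    x ^ suc (k ℕ.* (q ∸ 1))                  ≡⟨ x^[1+k*[q∸1]]≡x k x ⟩
    x                                        ∎

  ^-inverse : ∀ {s} → 1 ≤ s → gcd s (q ∸ 1) ≡ 1 →
              ∃ λ u → (∀ x → (x ^ s) ^ u ≡ x) × (∀ x → (x ^ u) ^ s ≡ x)
  ^-inverse {s} 1≤s gcd≡1 with coprime⇒inverse 1≤s gcd≡1
  ... | u , k , u*s≡1+k*[q∸1] = u , ^s^u≡id , ^u^s≡id
    where
    x^[u*s]≡x : ∀ x → x ^ (u ℕ.* s) ≡ x
    x^[u*s]≡x x = trans (cong (x ^_) u*s≡1+k*[q∸1]) (x^[1+k*[q∸1]]≡x k x)
    ^s^u≡id : ∀ x → (x ^ s) ^ u ≡ x
    ^s^u≡id x = trans (^-*-assoc x s u) (trans (cong (x ^_) (ℕ.*-comm s u)) (x^[u*s]≡x x))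
    ^u^s≡id : ∀ x → (x ^ u) ^ s ≡ x
    ^u^s≡id x = trans (^-*-assoc x u s) (x^[u*s]≡x x)

  ^-injective-∣ : ∀ {d s} → d ∣ s → Injective _≡_ _≡_ (_^ s) → Injective _≡_ _≡_ (_^ d)
  ^-injective-∣ {d} (divides t refl) ^s-injective {x} {y} x^d≡y^d = ^s-injective (begin
    x ^ (t ℕ.* d)  ≡⟨ cong (x ^_) (ℕ.*-comm t d) ⟩
    x ^ (d ℕ.* t)  ≡⟨ ^-*-assoc x d t ⟨
    (x ^ d) ^ t    ≡⟨ cong (_^ t) x^d≡y^d ⟩
    (y ^ d) ^ t    ≡⟨ ^-*-assoc y d t ⟩
    y ^ (d ℕ.* t)  ≡⟨ cong (y ^_) (ℕ.*-comm d t) ⟩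
    y ^ (t ℕ.* d)  ∎)

  ^-injective⇒≤1 : ∀ {d} → d ∣ q ∸ 1 → Injective _≡_ _≡_ (_^ d) → d ≤ 1
  ^-injective⇒≤1 {d} (divides zero q∸1≡0) _ =
    contradiction (trans (sym suc[q∸1]≡q) (cong suc q∸1≡0)) (ℕ.<⇒≢ 1<q ∘ sym)
  ^-injective⇒≤1 {d} (divides m@(suc j) q∸1≡m*d) ^d-injective =
    ℕ.*-cancelˡ-≤ m (subst (m ℕ.* d ≤_) (sym (ℕ.*-identityʳ m)) m*d≤m)
    where
    x^[1+m]≡x : ∀ x → x ^ suc m ≡ x
    x^[1+m]≡x x with x ≟ 0#
    ... | yes refl = 0^n≡0 (suc m) (s≤s z≤n)
    ... | no  x≢0  = trans (cong (x *_) x^m≡1) (*-identityʳ x)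
      where
      x^m≡1 : x ^ m ≡ 1#
      x^m≡1 = ^d-injective (begin
        (x ^ m) ^ d     ≡⟨ ^-*-assoc x m d ⟩
        x ^ (m ℕ.* d)   ≡⟨ cong (x ^_) q∸1≡m*d ⟨
        x ^ (q ∸ 1)     ≡⟨ x^[q∸1]≡1 x≢0 ⟩
        1#              ≡⟨ 1^n≡1 d ⟨
        1# ^ d          ∎)
    m*d≤m : m ℕ.* d ≤ m
    m*d≤m = ℕ.s≤s⁻¹ (subst (_≤ suc m) q≡1+m*d (x^[2+j]≡x⇒q≤2+j j x^[1+m]≡x))
      where
      q≡1+m*d : q ≡ suc (m ℕ.* d)
      q≡1+m*d = trans (sym suc[q∸1]≡q) (cong suc q∸1≡m*d)

  ^-injective⇒coprime : ∀ {s} → 1 ≤ s → Injective _≡_ _≡_ (_^ s) → gcd s (q ∸ 1) ≡ 1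
  ^-injective⇒coprime {s} 1≤s ^s-injective = ℕ.≤-antisym
    (^-injective⇒≤1 (gcd[m,n]∣n s (q ∸ 1)) (^-injective-∣ (gcd[m,n]∣m s (q ∸ 1)) ^s-injective))
    (ℕ.n≢0⇒n>0 (gcd[m,n]≢0 s (q ∸ 1) (inj₁ (ℕ.<⇒≢ 1≤s ∘ sym))))

  IsShiftingCostas-∘ : ∀ {f} (σ τ : Carrier → Carrier) → IsShiftingCostas f →
                       (∀ x → σ (τ x) ≡ x) → (∀ x → τ (σ x) ≡ x) →
                       (∀ x y → σ (x * y) ≡ σ x * σ y) → σ 0# ≡ 0# → σ 1# ≡ 1# →
                       IsShiftingCostas (f ∘ σ)
  IsShiftingCostas-∘ {f} σ τ (f-bijective , f-shifts) στ τσ σ-* σ0≡0 σ1≡1 =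
    Composition.bijective _≡_ _≡_ _≡_ σ-bijective f-bijective , shifts
    where
    σ-bijective : Bijective _≡_ _≡_ σ
    σ-bijective = inverseᵇ⇒bijective _≡_ refl sym trans
      (strictlyInverseˡ⇒inverseˡ σ στ , strictlyInverseʳ⇒inverseʳ σ τσ)
    σ-injective : Injective _≡_ _≡_ σ
    σ-injective = proj₁ σ-bijective
    shifts : ∀ d → d ≢ 1# → ∃ λ a → a ≢ 0# × (∀ x → f (σ (d * x)) - f (σ x) ≡ f (σ (a * x)))
    shifts d d≢1 with f-shifts (σ d) (d≢1 ∘ σ-injective ∘ λ σd≡1 → trans σd≡1 (sym σ1≡1))
    ... | a , a≢0 , shift = τ a , τa≢0 , λ x → begin
      f (σ (d * x)) - f (σ x)  ≡⟨ cong (λ y → f y - f (σ x)) (σ-* d x) ⟩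
      f (σ d * σ x) - f (σ x)  ≡⟨ shift (σ x) ⟩
      f (a * σ x)              ≡⟨ cong (λ b → f (b * σ x)) (στ a) ⟨
      f (σ (τ a) * σ x)        ≡⟨ cong f (σ-* (τ a) x) ⟨
      f (σ (τ a * x))          ∎
      where
      τa≢0 : τ a ≢ 0#
      τa≢0 τa≡0 = a≢0 (trans (sym (στ a)) (trans (cong σ τa≡0) σ0≡0))

lemma7p3 : (q : ℕ) → IsPrimePower q → (F : FiniteField q) →
    (f : FiniteField.Carrier F → FiniteField.Carrier F) →
    FiniteField.IsShiftingCostas F f →
    (s : ℕ) → 1 ≤ s →
    (FiniteField.IsShiftingCostas F (λ x → f (FiniteField._^_ F x s)) ⇔ (gcd s (q ∸ 1) ≡ 1))
lemma7p3 q _ F f f-costas s 1≤s = mk⇔ costas⇒coprime coprime⇒costas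
  where
  open FiniteField F
  open FiniteFieldProperties F
  costas⇒coprime : IsShiftingCostas (λ x → f (x ^ s)) → gcd s (q ∸ 1) ≡ 1
  costas⇒coprime ((f∘^s-injective , _) , _) = ^-injective⇒coprime 1≤s (f∘^s-injective ∘ cong f)
  coprime⇒costas : gcd s (q ∸ 1) ≡ 1 → IsShiftingCostas (λ x → f (x ^ s))
  coprime⇒costas gcd≡1 with ^-inverse 1≤s gcd≡1
  ... | u , ^s^u≡id , ^u^s≡id =
    IsShiftingCostas-∘ (_^ s) (_^ u) f-costas ^u^s≡id ^s^u≡id
      (λ x y → ^-distribʳ-* x y s) (0^n≡0 s 1≤s) (1^n≡1 s)
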